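{- Let $U$ be a $2$-cuttable unrooted binary phylogenetic network on $X$, and let $e$ be a cut-edge of $U$. Then $e$ induces a split.
   Context: An unrooted binary phylogenetic network on a non-empty finite set $X$ is a simple connected undirected graph whose internal vertices have degree $3$ and whose degree-$1$ vertices (leaves) are bijectively labeled by $X$. A cut-edge is an edge whose deletion disconnects the graph. $U$ is $2$-cuttable if every cycle contains a path of at least $2$ vertices each incident to a cut-edge. An $X$-split $X_1|X_2$ is a partition of $X$ into two non-empty sets; a cut-edge $e$ induces $X_1|X_2$ if $X_1|X_2$ is an $X$-split and every path in $U$ between a leaf in $X_1$ and a leaf in $X_2$ passes through $e$. -}

module Defs where

open import Data.Nat using (ℕ; zero; suc; _+_; _≤_; _<_; NonZero)
open import Data.Nat.DivMod using (_mod_)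
open import Data.Fin using (Fin; _≟_)
open import Data.Bool using (Bool; true; false; _∧_; _∨_; not; T)
open import Data.List using (List; []; _∷_; length; filter; allFin)
open import Data.List.Relation.Unary.Unique.Propositional using (Unique)
open import Data.Product using (Σ; ∃; _×_; _,_)
open import Data.Sum using (_⊎_)
open import Relation.Nullary using (¬_)
open import Relation.Nullary.Decidable using (⌊_⌋; T?)
open import Relation.Binary.PropositionalEquality using (_≡_)
open import Function.Definitions using (Injective)

Adjacency : ℕ → Set
Adjacency n = Fin n → Fin n → Bool

record IsSimpleGraph {n : ℕ} (adj : Adjacency n) : Set where
  field
    symmetric   : ∀ i j → adj i j ≡ adj j i
    irreflexive : ∀ i → adj i i ≡ false

module _ {n : ℕ} where

  degree : Adjacency n → Fin n → ℕ
  degree adj i = length (filter (λ j → T? (adj i j)) (allFin n))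

  data Walk (adj : Adjacency n) : Fin n → Fin n → Set where
    []  : ∀ {u} → Walk adj u u
    _∷_ : ∀ {u v w} → T (adj u v) → Walk adj v w → Walk adj u w

  vertices : ∀ {adj u v} → Walk adj u v → List (Fin n)
  vertices {u = u} []      = u ∷ []
  vertices {u = u} (_ ∷ p) = u ∷ vertices p

  IsPath : ∀ {adj u v} → Walk adj u v → Set
  IsPath p = Unique (vertices p)

  Connected : Adjacency n → Set
  Connected adj = ∀ u v → Walk adj u v

  Traverses : ∀ {adj u v} → Walk adj u v → Fin n → Fin n → Set
  Traverses {u = u} [] a b = Data.Empty.⊥
    where import Data.Empty
  Traverses {u = u} (_∷_ {v = v} _ p) a b =
    ((u ≡ a × v ≡ b) ⊎ (u ≡ b × v ≡ a)) ⊎ Traverses p a b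

  deleteEdge : Adjacency n → Fin n → Fin n → Adjacency n
  deleteEdge adj a b i j =
    adj i j ∧ not ((⌊ i ≟ a ⌋ ∧ ⌊ j ≟ b ⌋) ∨ (⌊ i ≟ b ⌋ ∧ ⌊ j ≟ a ⌋))

  IsCutEdge : Adjacency n → Fin n → Fin n → Set
  IsCutEdge adj a b = T (adj a b) × ¬ Connected (deleteEdge adj a b)

  IncidentToCutEdge : Adjacency n → Fin n → Set
  IncidentToCutEdge adj v = ∃ λ w → IsCutEdge adj v w

  record Cycle (adj : Adjacency n) (k : ℕ) .{{_ : NonZero k}} : Set where
    field
      three≤k  : 3 ≤ k
      vtx      : Fin k → Fin n
      distinct : Injective _≡_ _≡_ vtx
      adjacent : ∀ (i : ℕ) → T (adj (vtx (i mod k)) (vtx (suc i mod k)))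

  -- the cycle contains a path (a contiguous segment c s, c (s+1), …,
  -- c (s+l-1), indices mod k) of at least 2 vertices, each incident
  -- to a cut-edge
  HasCutPath : ∀ {adj k} .{{_ : NonZero k}} → Cycle adj k → Set
  HasCutPath {adj} {k} C =
    Σ ℕ λ s → Σ ℕ λ l → 2 ≤ l × l ≤ k ×
      (∀ j → j < l → IncidentToCutEdge adj (Cycle.vtx C ((s + j) mod k)))

  TwoCuttable : Adjacency n → Set
  TwoCuttable adj =
    ∀ (k : ℕ) .{{_ : NonZero k}} (C : Cycle adj k) → HasCutPath C

record IsUnrootedBinaryNetwork {n : ℕ} (m : ℕ) (adj : Adjacency n)
                               (ℓ : Fin m → Fin n) : Set where
  field
    X-nonempty  : 1 ≤ m
    simple      : IsSimpleGraph adj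
    connected   : Connected adj
    deg-1-or-3  : ∀ v → degree adj v ≡ 1 ⊎ degree adj v ≡ 3
    label-leaf  : ∀ x → degree adj (ℓ x) ≡ 1
    label-inj   : Injective _≡_ _≡_ ℓ
    label-onto  : ∀ v → degree adj v ≡ 1 → ∃ λ x → ℓ x ≡ v

-- An X-split X₁|X₂, X₁ = {x | σ x ≡ true}, X₂ = {x | σ x ≡ false}, both non-empty.
IsSplit : {m : ℕ} → (Fin m → Bool) → Set
IsSplit σ = (∃ λ x → σ x ≡ true) × (∃ λ x → σ x ≡ false)

Induces : {n m : ℕ} → Adjacency n → (Fin m → Fin n) → Fin n → Fin n →
          (Fin m → Bool) → Set
Induces adj ℓ a b σ =
  IsSplit σ ×
  (∀ x y → σ x ≡ true → σ y ≡ false →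
     (p : Walk adj (ℓ x) (ℓ y)) → IsPath p → Traverses p a b)

InducesASplit : {n m : ℕ} → Adjacency n → (Fin m → Fin n) → Fin n → Fin n → Set
InducesASplit {m = m} adj ℓ a b = ∃ λ (σ : Fin m → Bool) → Induces adj ℓ a b σ

-- Call side c d the set of vertices that reach d without using the edge {c, d}.
-- Every such side contains a leaf. Otherwise all its vertices have degree 3, so
-- a non-backtracking walk from d that never steps to c stays inside the side and
-- eventually closes a cycle there. By 2-cuttability that cycle has a vertex
-- w ≠ d incident to a cut-edge {w, z}, and orienting {w, z} away from c gives a
-- side strictly inside side c d. Well-founded induction on ⊂ then finishes.
-- For the cut-edge {a, b}, the sides of b and of a are disjoint and each
-- contains a labelled leaf. A walk between them that avoids {a, b} would join
-- them, so putting x in X₁ exactly when ℓ x lies on b's side gives the split.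
module Submission where

open import Defs
open import Data.Bool using (Bool; true; false; T; not; _∧_; _∨_)
open import Data.Bool.Properties using (∧-comm; ∨-comm; ∧-identityʳ; T-∧; T-≡; T-not-≡)
open import Data.Empty using (⊥-elim)
open import Data.Fin using (Fin; toℕ; fromℕ<; _≟_)
open import Data.Fin.Properties using (any?; pigeonhole; toℕ-injective; toℕ-fromℕ<; toℕ<n)
open import Data.Fin.Subset using (Subset; _∈_; _∉_; _⊆_; _⊂_; _⊃_; _∪_; ⁅_⁆)
open import Data.Fin.Subset.Properties using (_∈?_; p⊆p∪q; q⊆p∪q; x∈p∪q⁻; x∈⁅x⁆; x∈⁅y⁆⇒x≡y)
open import Data.Fin.Subset.Induction using (⊂-wellFounded; ⊃-wellFounded; Acc; acc)
open import Data.List using ([]; _∷_; length; allFin)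
open import Data.List.Relation.Unary.All using (All; []; _∷_)
open import Data.List.Relation.Unary.All.Properties using (all-filter)
open import Data.List.Relation.Unary.AllPairs using ([]; _∷_)
open import Data.List.Relation.Unary.Unique.Propositional using (Unique)
open import Data.List.Relation.Unary.Unique.Propositional.Properties using (allFin⁺; filter⁺)
open import Data.Nat using (ℕ; zero; suc; _+_; _∸_; _≤_; _<_; _%_; s≤s; z≤n; NonZero)
import Data.Nat as ℕ
open import Data.Nat.DivMod using (_mod_; m%n<n; %-distribˡ-+; m<n⇒m%n≡m; n%n≡0)
open import Data.Nat.Properties
  using ( ≤-reflexive; ≤-trans; <⇒≢; <⇒≤; n<1+n; m≤n⇒m<n∨m≡n; m∸n+n≡m
        ; +-cancelʳ-≡; +-monoˡ-<; +-identityʳ; +-comm)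
open import Data.Product using (Σ; ∃; ∃₂; _×_; _,_; proj₁; proj₂; map₂)
open import Data.Sum using (_⊎_; inj₁; inj₂; [_,_]′)
import Data.Sum as Sum
open import Function using (id; _∘_; Equivalence)
open import Relation.Binary.Definitions using (DecidableEquality)
open import Relation.Binary.PropositionalEquality
  using (_≡_; _≢_; refl; sym; trans; cong; cong₂; subst; subst₂)
open import Relation.Nullary using (¬_; yes; no; _×-dec_; ¬?)
open import Relation.Nullary.Decidable
  using (T?; ⌊_⌋; toSum; toWitness; fromWitness; toWitnessFalse; fromWitnessFalse)

module _ {A : Set} (_≟ᴬ_ : DecidableEquality A) where

  private
    one-of-two-avoids : ∀ {y z} → y ≢ z → ∀ u → y ≢ u ⊎ z ≢ u
    one-of-two-avoids {y} y≢z u with y ≟ᴬ u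
    ... | yes refl = inj₂ (y≢z ∘ sym)
    ... | no y≢u   = inj₁ y≢u

  avoiding-member : ∀ {P : A → Set} {xs} → 3 ≤ length xs → Unique xs → All P xs →
                    ∀ u₁ u₂ → ∃ λ w → P w × w ≢ u₁ × w ≢ u₂
  avoiding-member {xs = _ ∷ []}     (s≤s ())       _ _ _ _
  avoiding-member {xs = _ ∷ _ ∷ []} (s≤s (s≤s ())) _ _ _ _
  avoiding-member {xs = x ∷ y ∷ z ∷ _} _
                  ((x≢y ∷ x≢z ∷ _) ∷ (y≢z ∷ _) ∷ _) (px ∷ py ∷ pz ∷ _) u₁ u₂
    with x ≟ᴬ u₁ | x ≟ᴬ u₂
  ... | no x≢u₁  | no x≢u₂  = x , px , x≢u₁ , x≢u₂
  ... | yes refl | _        =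
    [ (λ y≢u₂ → y , py , x≢y ∘ sym , y≢u₂) , (λ z≢u₂ → z , pz , x≢z ∘ sym , z≢u₂) ]′ (one-of-two-avoids y≢z u₂)
  ... | no _     | yes refl =
    [ (λ y≢u₁ → y , py , y≢u₁ , x≢y ∘ sym) , (λ z≢u₁ → z , pz , z≢u₁ , x≢z ∘ sym) ]′ (one-of-two-avoids y≢z u₁)

suc-mod-or-wrap : ∀ i k → let m = suc (suc k) in
                  suc i % m ≡ suc (i % m) ⊎ (suc i % m ≡ 0 × suc (i % m) ≡ m)
suc-mod-or-wrap i k with m≤n⇒m<n∨m≡n (m%n<n i (suc (suc k)))
... | inj₁ below = inj₁ (trans (%-distribˡ-+ 1 i (suc (suc k))) (m<n⇒m%n≡m below))
... | inj₂ wraps = inj₂ ( trans (%-distribˡ-+ 1 i (suc (suc k)))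
                                (trans (cong (_% suc (suc k)) wraps) (n%n≡0 (suc (suc k))))
                        , wraps)

module _ {n : ℕ} (f : ℕ → Fin n) where

  InjectiveBelow : ℕ → Set
  InjectiveBelow j = ∀ {a b} → a < j → b < j → f a ≡ f b → a ≡ b

  FirstRevisit : Set
  FirstRevisit = ∃₂ λ i j → i < j × f i ≡ f j × InjectiveBelow j

  injective-below-or-revisit : ∀ k → InjectiveBelow k ⊎ FirstRevisit
  injective-below-or-revisit zero = inj₁ λ ()
  injective-below-or-revisit (suc k) with injective-below-or-revisit k
  ... | inj₂ revisit = inj₂ revisit
  ... | inj₁ injective with any? (λ (i : Fin k) → f (toℕ i) ≟ f k)
  ...   | yes (i , same) = inj₂ (toℕ i , k , toℕ<n i , same , injective)
  ...   | no unseen      = inj₁ extended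
    where
    new : ∀ {a} → a < k → f a ≢ f k
    new a<k same = unseen (fromℕ< a<k , trans (cong f (toℕ-fromℕ< a<k)) same)

    extended : InjectiveBelow (suc k)
    extended (s≤s a≤k) (s≤s b≤k) same with m≤n⇒m<n∨m≡n a≤k | m≤n⇒m<n∨m≡n b≤k
    ... | inj₁ a<k  | inj₁ b<k  = injective a<k b<k same
    ... | inj₁ a<k  | inj₂ refl = ⊥-elim (new a<k same)
    ... | inj₂ refl | inj₁ b<k  = ⊥-elim (new b<k (sym same))
    ... | inj₂ refl | inj₂ refl = refl

  first-revisit : FirstRevisit
  first-revisit with injective-below-or-revisit (suc n)
  ... | inj₂ revisit   = revisit
  ... | inj₁ injective with pigeonhole (n<1+n n) (f ∘ toℕ)
  ...   | i , j , i<j , same = ⊥-elim (<⇒≢ i<j (injective (toℕ<n i) (toℕ<n j) same))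

SameEdge : ∀ {n} → Fin n → Fin n → Fin n → Fin n → Set
SameEdge a b u v = (u ≡ a × v ≡ b) ⊎ (u ≡ b × v ≡ a)

Undirected : ∀ {n} → Adjacency n → Set
Undirected K = ∀ i j → K i j ≡ K j i

infix 4 _⊆ᴱ_

_⊆ᴱ_ : ∀ {n} → Adjacency n → Adjacency n → Set
K ⊆ᴱ K′ = ∀ {i j} → T (K i j) → T (K′ i j)

module _ {n : ℕ} {K : Adjacency n} where

  infixr 5 _++ʷ_

  _++ʷ_ : ∀ {u v w} → Walk K u v → Walk K v w → Walk K u w
  []      ++ʷ q = q
  (e ∷ p) ++ʷ q = e ∷ (p ++ʷ q)

  reverseʷ : Undirected K → ∀ {u v} → Walk K u v → Walk K v u
  reverseʷ undirected []                = []
  reverseʷ undirected (_∷_ {u} {v} e p) = reverseʷ undirected p ++ʷ (subst T (undirected u v) e ∷ [])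

  mapʷ : ∀ {K′} → K ⊆ᴱ K′ → ∀ {u v} → Walk K u v → Walk K′ u v
  mapʷ K⊆K′ []      = []
  mapʷ K⊆K′ (e ∷ p) = K⊆K′ e ∷ mapʷ K⊆K′ p

module _ {n : ℕ} where

  deleteEdge-⊆ : ∀ K (a b : Fin n) → deleteEdge K a b ⊆ᴱ K
  deleteEdge-⊆ K a b = proj₁ ∘ Equivalence.to T-∧

  deleteEdge-mono : ∀ {K K′} (a b : Fin n) → K ⊆ᴱ K′ → deleteEdge K a b ⊆ᴱ deleteEdge K′ a b
  deleteEdge-mono a b K⊆K′ e with Equivalence.to T-∧ e
  ... | kept , not-ab = Equivalence.from T-∧ (K⊆K′ kept , not-ab)

  deleteEdge-comm : ∀ K (a b : Fin n) → deleteEdge K a b ⊆ᴱ deleteEdge K b a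
  deleteEdge-comm K a b {i} {j} =
    subst T (cong (λ s → K i j ∧ not s)
                  (∨-comm (⌊ i ≟ a ⌋ ∧ ⌊ j ≟ b ⌋) (⌊ i ≟ b ⌋ ∧ ⌊ j ≟ a ⌋)))

  deleteEdge-undirected : ∀ {K} (a b : Fin n) → Undirected K → Undirected (deleteEdge K a b)
  deleteEdge-undirected a b undirected i j =
    cong₂ (λ k s → k ∧ not s) (undirected i j)
          (trans (∨-comm (⌊ i ≟ a ⌋ ∧ ⌊ j ≟ b ⌋) (⌊ i ≟ b ⌋ ∧ ⌊ j ≟ a ⌋))
                 (cong₂ _∨_ (∧-comm ⌊ i ≟ b ⌋ ⌊ j ≟ a ⌋) (∧-comm ⌊ i ≟ a ⌋ ⌊ j ≟ b ⌋)))

  deleteEdge-cases : ∀ K (a b u v : Fin n) → SameEdge a b u v ⊎ deleteEdge K a b u v ≡ K u v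
  deleteEdge-cases K a b u v with u ≟ a | v ≟ b | u ≟ b | v ≟ a
  ... | yes u≡a | yes v≡b | _       | _       = inj₁ (inj₁ (u≡a , v≡b))
  ... | _       | _       | yes u≡b | yes v≡a = inj₁ (inj₂ (u≡b , v≡a))
  ... | no _    | _       | no _    | _       = inj₂ (∧-identityʳ (K u v))
  ... | no _    | _       | yes _   | no _    = inj₂ (∧-identityʳ (K u v))
  ... | yes _   | no _    | no _    | _       = inj₂ (∧-identityʳ (K u v))
  ... | yes _   | no _    | yes _   | no _    = inj₂ (∧-identityʳ (K u v))

module _ {n : ℕ} {K : Adjacency n} (a b : Fin n) where

  traverses-or-avoids : ∀ {u v} (p : Walk K u v) → Traverses p a b ⊎ Walk (deleteEdge K a b) u v
  traverses-or-avoids []                = inj₂ []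
  traverses-or-avoids (_∷_ {u} {w} e p) with deleteEdge-cases K a b u w | traverses-or-avoids p
  ... | inj₁ same | _      = inj₁ (inj₁ same)
  ... | inj₂ _    | inj₁ t = inj₁ (inj₂ t)
  ... | inj₂ kept | inj₂ q = inj₂ (subst T (sym kept) e ∷ q)

  avoids-or-reaches-endpoint : ∀ {u v} → Walk K u v →
    Walk (deleteEdge K a b) u v ⊎ (Walk (deleteEdge K a b) u a ⊎ Walk (deleteEdge K a b) u b)
  avoids-or-reaches-endpoint []                = inj₁ []
  avoids-or-reaches-endpoint (_∷_ {u} {w} e p) with deleteEdge-cases K a b u w
  ... | inj₁ (inj₁ (refl , _)) = inj₂ (inj₁ [])
  ... | inj₁ (inj₂ (refl , _)) = inj₂ (inj₂ [])
  ... | inj₂ kept = Sum.map (e′ ∷_) (Sum.map (e′ ∷_) (e′ ∷_)) (avoids-or-reaches-endpoint p)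
    where
    e′ : T (deleteEdge K a b u w)
    e′ = subst T (sym kept) e

module Reachability {n : ℕ} (K : Adjacency n) (t : Fin n) where

  private
    Closed : Subset n → Set
    Closed S = ∀ {u w} → T (K u w) → w ∈ S → u ∈ S

    Sound : Subset n → Set
    Sound S = ∀ {u} → u ∈ S → Walk K u t

    record Closure : Set where
      field
        set    : Subset n
        closed : Closed set
        sound  : Sound set
        target : t ∈ set

    saturate : ∀ S → Acc _⊃_ S → Sound S → t ∈ S → Closure
    saturate S (acc larger) sound t∈S
      with any? (λ u → any? (λ w → T? (K u w) ×-dec w ∈? S ×-dec ¬? (u ∈? S)))
    ... | yes (u , w , e , w∈S , u∉S) =
      saturate (S ∪ ⁅ u ⁆) (larger (p⊆p∪q ⁅ u ⁆ , u , q⊆p∪q S ⁅ u ⁆ (x∈⁅x⁆ u) , u∉S))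
               sound′ (p⊆p∪q ⁅ u ⁆ t∈S)
      where
      sound′ : Sound (S ∪ ⁅ u ⁆)
      sound′ v∈ with x∈p∪q⁻ S ⁅ u ⁆ v∈
      ... | inj₁ v∈S   = sound v∈S
      ... | inj₂ v∈⁅u⁆ rewrite x∈⁅y⁆⇒x≡y u v∈⁅u⁆ = e ∷ sound w∈S
    ... | no no-missing = record { set = S ; closed = closed ; sound = sound ; target = t∈S }
      where
      closed : Closed S
      closed {u} {w} e w∈S with u ∈? S
      ... | yes u∈S = u∈S
      ... | no u∉S  = ⊥-elim (no-missing (u , w , e , w∈S , u∉S))

    closure : Closure
    closure = saturate ⁅ t ⁆ (⊃-wellFounded ⁅ t ⁆) only-t (x∈⁅x⁆ t)
      where
      only-t : Sound ⁅ t ⁆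
      only-t v∈⁅t⁆ rewrite x∈⁅y⁆⇒x≡y t v∈⁅t⁆ = []

  reaching : Subset n
  reaching = Closure.set closure

  ∈-reaching⁻ : ∀ {u} → u ∈ reaching → Walk K u t
  ∈-reaching⁻ = Closure.sound closure

  ∈-reaching⁺ : ∀ {u} → Walk K u t → u ∈ reaching
  ∈-reaching⁺ []      = Closure.target closure
  ∈-reaching⁺ (e ∷ p) = Closure.closed closure e (∈-reaching⁺ p)

cut-edge-swap : ∀ {n} {adj : Adjacency n} {a b} → Undirected adj → IsCutEdge adj a b → IsCutEdge adj b a
cut-edge-swap {adj = adj} {a} {b} undirected (ab , disconnected) =
  subst T (undirected a b) ab ,
  λ connected → disconnected λ u v → mapʷ (deleteEdge-comm adj b a) (connected u v)

module Sides {n : ℕ} {adj : Adjacency n} (undirected : Undirected adj) where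

  side : Fin n → Fin n → Subset n
  side c d = Reachability.reaching (deleteEdge adj c d) d

  module _ {c d : Fin n} where

    ∈-side⁺ : ∀ {u} → Walk (deleteEdge adj c d) u d → u ∈ side c d
    ∈-side⁺ = Reachability.∈-reaching⁺ (deleteEdge adj c d) d

    ∈-side⁻ : ∀ {u} → u ∈ side c d → Walk (deleteEdge adj c d) u d
    ∈-side⁻ = Reachability.∈-reaching⁻ (deleteEdge adj c d) d

    side-closed : ∀ {u v} → Walk (deleteEdge adj c d) u v → v ∈ side c d → u ∈ side c d
    side-closed p v∈ = ∈-side⁺ (p ++ʷ ∈-side⁻ v∈)

    side-step : ∀ {u v} → T (adj v u) → u ∈ side c d → v ∈ side c d ⊎ (v ≡ c × u ≡ d)
    side-step {u} {v} e u∈ with deleteEdge-cases adj c d v u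
    ... | inj₁ (inj₁ crossing)   = inj₂ crossing
    ... | inj₁ (inj₂ (refl , _)) = inj₁ (∈-side⁺ [])
    ... | inj₂ kept              = inj₁ (side-closed (subst T (sym kept) e ∷ []) u∈)

    leaving-side-traverses : ∀ {u v} (p : Walk adj u v) → u ∈ side c d → v ∉ side c d → Traverses p c d
    leaving-side-traverses p u∈ v∉ with traverses-or-avoids c d p
    ... | inj₁ traverses = traverses
    ... | inj₂ avoids    = ⊥-elim (v∉ (side-closed (reverseʷ (deleteEdge-undirected c d undirected) avoids) u∈))

  module _ (connected : Connected adj) where

    reaches-an-endpoint : ∀ a b v → Walk (deleteEdge adj a b) v a ⊎ Walk (deleteEdge adj a b) v b
    reaches-an-endpoint a b v with avoids-or-reaches-endpoint a b (connected v a)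
    ... | inj₁ v⇝a  = inj₁ v⇝a
    ... | inj₂ v⇝ab = v⇝ab

    cut-edge-separates : ∀ {a b} → IsCutEdge adj a b → ¬ Walk (deleteEdge adj a b) a b
    cut-edge-separates {a} {b} (_ , disconnected) a⇝b =
      disconnected λ u v → to-a u ++ʷ reverseʷ undirected′ (to-a v)
      where
      undirected′ : Undirected (deleteEdge adj a b)
      undirected′ = deleteEdge-undirected a b undirected

      to-a : ∀ w → Walk (deleteEdge adj a b) w a
      to-a w with reaches-an-endpoint a b w
      ... | inj₁ w⇝a = w⇝a
      ... | inj₂ w⇝b = w⇝b ++ʷ reverseʷ undirected′ a⇝b

    cut-edge-∉-side : ∀ {c d} → IsCutEdge adj c d → c ∉ side c d
    cut-edge-∉-side cut = cut-edge-separates cut ∘ ∈-side⁻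

    sides-disjoint : ∀ {a b u} → IsCutEdge adj a b → u ∈ side b a → u ∉ side a b
    sides-disjoint {a} {b} cut u∈ba u∈ab = cut-edge-separates cut
      (reverseʷ (deleteEdge-undirected a b undirected) (mapʷ (deleteEdge-comm adj b a) (∈-side⁻ u∈ba))
       ++ʷ ∈-side⁻ u∈ab)

    side-shrinks : ∀ {c d c′ d′} → IsCutEdge adj c′ d′ → c′ ∈ side c d → d′ ∈ side c d →
                   Walk (deleteEdge adj c′ d′) c c′ → side c′ d′ ⊂ side c d
    side-shrinks {c} {d} {c′} {d′} cut′ c′∈ d′∈ c⇝c′ = inward , c′ , c′∈ , cut-edge-∉-side cut′
      where
      H′ : Adjacency n
      H′ = deleteEdge adj c′ d′

      undirected′ : Undirected H′
      undirected′ = deleteEdge-undirected c′ d′ undirected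

      narrow : deleteEdge H′ c d ⊆ᴱ deleteEdge adj c d
      narrow = deleteEdge-mono {K = H′} c d (deleteEdge-⊆ adj c′ d′)

      inward : side c′ d′ ⊆ side c d
      inward u∈ with avoids-or-reaches-endpoint c d (∈-side⁻ u∈)
      ... | inj₁ u⇝d′       = side-closed (mapʷ narrow u⇝d′) d′∈
      ... | inj₂ (inj₂ u⇝d) = ∈-side⁺ (mapʷ narrow u⇝d)
      ... | inj₂ (inj₁ u⇝c) = ⊥-elim (cut-edge-separates cut′
            (reverseʷ undirected′ c⇝c′ ++ʷ reverseʷ undirected′ (mapʷ (deleteEdge-⊆ H′ c d) u⇝c)
             ++ʷ ∈-side⁻ u∈))

neighbour-avoiding : ∀ {n} (adj : Adjacency n) v → 3 ≤ degree adj v →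
                     ∀ u₁ u₂ → ∃ λ w → T (adj v w) × w ≢ u₁ × w ≢ u₂
neighbour-avoiding {n} adj v three≤deg = avoiding-member _≟_ three≤deg
  (filter⁺ (λ w → T? (adj v w)) (allFin⁺ n)) (all-filter (λ w → T? (adj v w)) (allFin n))

module _ {n : ℕ} {adj : Adjacency n} where

  adjacent-distinct : (∀ i → adj i i ≡ false) → ∀ {u v} → T (adj u v) → u ≢ v
  adjacent-distinct irreflexive {u} e refl = subst T (irreflexive u) e

  closed-path-cycle : ∀ k (g : ℕ → Fin n) → (∀ r → T (adj (g r) (g (suc r)))) →
                      g (3 + k) ≡ g 0 → InjectiveBelow g (3 + k) → Cycle adj (3 + k)
  closed-path-cycle k g step closes distinct = record
    { three≤k  = s≤s (s≤s (s≤s z≤n))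
    ; vtx      = g ∘ toℕ
    ; distinct = λ {t} {t′} same → toℕ-injective (distinct (toℕ<n t) (toℕ<n t′) same)
    ; adjacent = λ i → subst₂ (λ r r′ → T (adj (g r) (g r′)))
                              (sym (toℕ-fromℕ< (m%n<n i (3 + k))))
                              (sym (toℕ-fromℕ< (m%n<n (suc i) (3 + k))))
                              (around i)
    }
    where
    around : ∀ i → T (adj (g (i % (3 + k))) (g (suc i % (3 + k))))
    around i with suc-mod-or-wrap i (suc k)
    ... | inj₁ next          = subst (λ r → T (adj (g (i % (3 + k))) (g r))) (sym next) (step (i % (3 + k)))
    ... | inj₂ (to0 , wraps) = subst (λ v → T (adj (g (i % (3 + k))) v))
                                     (trans (cong g wraps) (trans closes (cong g (sym to0))))
                                     (step (i % (3 + k)))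

  non-backtracking-cycle : (∀ i → adj i i ≡ false) → (f : ℕ → Fin n) →
                           (∀ i → T (adj (f i) (f (suc i)))) → (∀ i → f (suc (suc i)) ≢ f i) →
                           ∃ λ k → Σ (Cycle adj (3 + k)) λ C → ∀ t → ∃ λ i → Cycle.vtx C t ≡ f i
  non-backtracking-cycle irreflexive f step no-return with first-revisit f
  ... | i , j , i<j , same , distinct = from-gap (j ∸ i) (m∸n+n≡m (<⇒≤ i<j)) i<j same distinct
    where
    from-gap : ∀ {j} gap → gap + i ≡ j → i < j → f i ≡ f j → InjectiveBelow f j →
               ∃ λ k → Σ (Cycle adj (3 + k)) λ C → ∀ t → ∃ λ i → Cycle.vtx C t ≡ f i
    from-gap 0 refl i<i _    _ = ⊥-elim (<⇒≢ i<i refl)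
    from-gap 1 refl _   same _ = ⊥-elim (adjacent-distinct irreflexive (step i) same)
    from-gap 2 refl _   same _ = ⊥-elim (no-return i (sym same))
    from-gap (suc (suc (suc k))) refl _ same distinct =
      k , closed-path-cycle k (λ r → f (r + i)) (λ r → step (r + i)) (sym same) shifted , λ t → toℕ t + i , refl
      where
      shifted : InjectiveBelow (λ r → f (r + i)) (3 + k)
      shifted a<k b<k same = +-cancelʳ-≡ i _ _ (distinct (+-monoˡ-< i a<k) (+-monoˡ-< i b<k) same)

  consecutive-cut-vertices : TwoCuttable adj → ∀ {k} .{{_ : NonZero k}} (C : Cycle adj k) →
                             ∃ λ s → IncidentToCutEdge adj (Cycle.vtx C (s mod k))
                                   × IncidentToCutEdge adj (Cycle.vtx C (suc s mod k))
  consecutive-cut-vertices two-cuttable {k} C with two-cuttable k C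
  ... | s , _ , 2≤l , _ , incident =
    s , incident-at (+-identityʳ s) (incident 0 (≤-trans (s≤s z≤n) 2≤l))
      , incident-at (+-comm s 1) (incident 1 2≤l)
    where
    incident-at : ∀ {r r′} → r ≡ r′ → IncidentToCutEdge adj (Cycle.vtx C (r mod k)) →
                  IncidentToCutEdge adj (Cycle.vtx C (r′ mod k))
    incident-at = subst (λ r → IncidentToCutEdge adj (Cycle.vtx C (r mod k)))

  cut-vertex-avoiding : (∀ i → adj i i ≡ false) → TwoCuttable adj →
                        ∀ {k} .{{_ : NonZero k}} (C : Cycle adj k) d →
                        ∃ λ t → Cycle.vtx C t ≢ d × IncidentToCutEdge adj (Cycle.vtx C t)
  cut-vertex-avoiding irreflexive two-cuttable {k} C d with consecutive-cut-vertices two-cuttable C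
  ... | s , incident-s , incident-suc-s with Cycle.vtx C (s mod k) ≟ d
  ...   | no vₛ≢d  = s mod k , vₛ≢d , incident-s
  ...   | yes vₛ≡d =
    suc s mod k , adjacent-distinct irreflexive (Cycle.adjacent C s) ∘ trans vₛ≡d ∘ sym , incident-suc-s

module Leaves {n : ℕ} {adj : Adjacency n} (simple : IsSimpleGraph adj) (connected : Connected adj)
              (two-cuttable : TwoCuttable adj)
              (leaf-or-branching : ∀ v → degree adj v ≡ 1 ⊎ 3 ≤ degree adj v) where

  open IsSimpleGraph simple
  open Sides symmetric

  LeafIn : Subset n → Set
  LeafIn S = ∃ λ v → degree adj v ≡ 1 × v ∈ S

  module _ {c d : Fin n} (leafless : ¬ LeafIn (side c d)) where

    branching : ∀ {v} → v ∈ side c d → 3 ≤ degree adj v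
    branching {v} v∈ with leaf-or-branching v
    ... | inj₁ leaf   = ⊥-elim (leafless (v , leaf , v∈))
    ... | inj₂ three≤ = three≤

    step-within : ∀ u {v} → v ∈ side c d → ∃ λ w → T (adj v w) × w ≢ u × w ∈ side c d
    step-within u {v} v∈ with neighbour-avoiding adj v (branching v∈) u c
    ... | w , vw , w≢u , w≢c =
      w , vw , w≢u , [ id , ⊥-elim ∘ w≢c ∘ proj₁ ]′ (side-step (subst T (symmetric v w) vw) v∈)

    -- (previous, current) vertex of a non-backtracking walk from d that never steps to c
    trail : ℕ → Fin n × ∃ (_∈ side c d)
    trail zero    = c , d , ∈-side⁺ []
    trail (suc i) with trail i
    ... | u , v , v∈ with step-within u v∈
    ...   | w , _ , _ , w∈ = v , w , w∈

    current : ℕ → Fin n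
    current = proj₁ ∘ proj₂ ∘ trail

    current-∈-side : ∀ i → current i ∈ side c d
    current-∈-side = proj₂ ∘ proj₂ ∘ trail

    current-adjacent : ∀ i → T (adj (current i) (current (suc i)))
    current-adjacent i = proj₁ (proj₂ (step-within _ (current-∈-side i)))

    current-no-return : ∀ i → current (suc (suc i)) ≢ current i
    current-no-return i = proj₁ (proj₂ (proj₂ (step-within _ (current-∈-side (suc i)))))

    cycle-in-side : ∃ λ k → Σ (Cycle adj (3 + k)) λ C → ∀ t → Cycle.vtx C t ∈ side c d
    cycle-in-side with non-backtracking-cycle irreflexive current current-adjacent current-no-return
    ... | k , C , on-trail =
      k , C , λ t → subst (_∈ side c d) (sym (proj₂ (on-trail t))) (current-∈-side (proj₁ (on-trail t)))

    smaller-side : ∃₂ λ c′ d′ → side c′ d′ ⊂ side c d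
    smaller-side with cycle-in-side
    ... | k , C , inside with cut-vertex-avoiding irreflexive two-cuttable C d
    ...   | t , w≢d , z , cut-wz = orient (reaches-an-endpoint connected w z c)
      where
      w : Fin n
      w = Cycle.vtx C t

      w∈ : w ∈ side c d
      w∈ = inside t

      z∈ : z ∈ side c d
      z∈ = [ id , ⊥-elim ∘ w≢d ∘ proj₂ ]′ (side-step (subst T (symmetric w z) (proj₁ cut-wz)) w∈)

      orient : Walk (deleteEdge adj w z) c w ⊎ Walk (deleteEdge adj w z) c z →
               ∃₂ λ c′ d′ → side c′ d′ ⊂ side c d
      orient (inj₁ c⇝w) = w , z , side-shrinks connected cut-wz w∈ z∈ c⇝w
      orient (inj₂ c⇝z) = z , w , side-shrinks connected (cut-edge-swap symmetric cut-wz) z∈ w∈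
                                                 (mapʷ (deleteEdge-comm adj w z) c⇝z)

  LeafIn-mono : ∀ {S S′} → S ⊆ S′ → LeafIn S → LeafIn S′
  LeafIn-mono S⊆S′ (v , leaf , v∈) = v , leaf , S⊆S′ v∈

  leaf-in-side′ : ∀ {c d} → Acc _⊂_ (side c d) → LeafIn (side c d)
  leaf-in-side′ {c} {d} (acc smaller) =
    [ id , descend ∘ smaller-side ]′ (toSum (any? λ v → degree adj v ℕ.≟ 1 ×-dec v ∈? side c d))
    where
    descend : (∃₂ λ c′ d′ → side c′ d′ ⊂ side c d) → LeafIn (side c d)
    descend (_ , _ , shrinks) = LeafIn-mono (proj₁ shrinks) (leaf-in-side′ (smaller shrinks))

  leaf-in-side : ∀ c d → LeafIn (side c d)
  leaf-in-side c d = leaf-in-side′ (⊂-wellFounded (side c d))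

lemma4 : ∀ {n m : ℕ} (adj : Adjacency n) (ℓ : Fin m → Fin n) →
           IsUnrootedBinaryNetwork m adj ℓ → TwoCuttable adj →
           ∀ (a b : Fin n) → IsCutEdge adj a b → InducesASplit adj ℓ a b
lemma4 {m = m} adj ℓ network two-cuttable a b cut = σ , split , separated
  where
  open IsUnrootedBinaryNetwork network
  open IsSimpleGraph simple
  open Sides symmetric
  open Leaves simple connected two-cuttable (Sum.map₂ (≤-reflexive ∘ sym) ∘ deg-1-or-3)

  σ : Fin m → Bool
  σ x = ⌊ ℓ x ∈? side a b ⌋

  labelled : ∀ {S} → LeafIn S → ∃ λ x → ℓ x ∈ S
  labelled (v , leaf , v∈) with label-onto v leaf
  ... | x , refl = x , v∈

  split : IsSplit σ
  split = map₂ (Equivalence.to T-≡ ∘ fromWitness) (labelled (leaf-in-side a b))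
        , map₂ (Equivalence.to T-not-≡ ∘ fromWitnessFalse ∘ sides-disjoint connected cut)
               (labelled (leaf-in-side b a))

  -- holds for every walk, not only for paths
  separated : ∀ x y → σ x ≡ true → σ y ≡ false → (p : Walk adj (ℓ x) (ℓ y)) → IsPath p → Traverses p a b
  separated x y σx σy p _ = leaving-side-traverses p (toWitness (Equivalence.from T-≡ σx))
                                                     (toWitnessFalse (Equivalence.from T-not-≡ σy))
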